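{- Let $T_1,T_2$ be full skew trees with $n$ internal nodes and associated permutations $\sigma$ and $\tau$ respectively. Then $d(T_1,T_2)=1$ if and only if $\sigma\sim\tau$.
   Context: A full binary tree is a rooted ordered tree whose nodes are leaves or internal nodes with exactly two children; a full skew tree is one in which every internal node has at least one leaf child. For a full binary tree with $n$ internal nodes, label the internal nodes $1,\dots,n$ so that the in-order traversal is $1,\dots,n$; the associated permutation $\sigma$ lists the labels in pre-order traversal. A right rotation at an internal node $a$ whose left child $b$ is internal, with $C,D$ the subtrees of $b$ and $E$ the right subtree of $a$, replaces the subtree at $a$ by the tree with root $b$, left subtree $C$, right child $a$ having subtrees $D,E$; a left rotation is its inverse. $d(T_1,T_2)$ is the minimum number of rotations transforming $T_1$ into $T_2$. For permutations $\sigma,\tau$ of $[n]$, write $\sigma\sim\tau$ ($\tau$ is a skew transposition of $\sigma$) if there is an index $i$ (with $i+1\le n$) such that (1) $\sigma(i)$ equals $\min$ or $\max$ of $\{\sigma(i),\sigma(i+1),\dots,\sigma(n)\}$; (2) $\sigma(i+1)$ equals $\min$ or $\max$ of $\{\sigma(i),\sigma(i+1),\dots,\sigma(n)\}$; (3) $\tau(i)=\sigma(i+1)$, $\tau(i+1)=\sigma(i)$, and $\tau(j)=\sigma(j)$ for all $j\notin\{i,i+1\}$. -}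

module Defs where

open import Data.Nat using (ℕ; zero; suc; _+_; _≤_; _<_)
open import Data.List using (List; []; _∷_; _++_)
open import Data.List.Relation.Unary.All using (All)
open import Data.Product using (Σ; _×_; ∃-syntax)
open import Data.Sum using (_⊎_)
open import Relation.Nullary using (¬_)
open import Relation.Binary.PropositionalEquality using (_≡_)

data Tree : Set where
  leaf : Tree
  node : Tree → Tree → Tree

internal : Tree → ℕ
internal leaf       = 0
internal (node l r) = suc (internal l + internal r)

data Skew : Tree → Set where
  skew-leaf : Skew leaf
  skew-L    : ∀ {r} → Skew r → Skew (node leaf r)
  skew-R    : ∀ {l} → Skew l → Skew (node l leaf)

-- Associated permutation: internal nodes labelled so that in-order traversal
-- is 1,…,n; the permutation lists labels in pre-order.
-- 'preorder k T' labels the internal nodes of T in in-order with k+1, k+2, …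
preorder : ℕ → Tree → List ℕ
preorder k leaf       = []
preorder k (node l r) =
  (k + internal l + 1) ∷ (preorder k l ++ preorder (k + internal l + 1) r)

perm : Tree → List ℕ
perm = preorder 0

data RRot : Tree → Tree → Set where
  here  : ∀ C D E → RRot (node (node C D) E) (node C (node D E))
  left  : ∀ {A A'} B → RRot A A' → RRot (node A B) (node A' B)
  right : ∀ A {B B'} → RRot B B' → RRot (node A B) (node A B')

Rot : Tree → Tree → Set
Rot T T' = RRot T T' ⊎ RRot T' T

data Steps : ℕ → Tree → Tree → Set where
  stop : ∀ {T} → Steps 0 T T
  step : ∀ {k T U V} → Rot T U → Steps k U V → Steps (suc k) T V

Dist : Tree → Tree → ℕ → Set
Dist T₁ T₂ k = Steps k T₁ T₂ × (∀ m → m < k → ¬ Steps m T₁ T₂)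

MinOrMax : ℕ → List ℕ → Set
MinOrMax x xs = All (x ≤_) xs ⊎ All (_≤ x) xs

-- Skew transposition: σ ∼ τ iff σ = p ++ a ∷ b ∷ s, τ = p ++ b ∷ a ∷ s with
-- a and b each the min or max of {a, b} ∪ s  (i = length p + 1, i+1 ≤ n).
_∼_ : List ℕ → List ℕ → Set
σ ∼ τ = ∃[ p ] ∃[ a ] ∃[ b ] ∃[ s ]
  (σ ≡ p ++ (a ∷ b ∷ s)) × (τ ≡ p ++ (b ∷ a ∷ s))
  × MinOrMax a (a ∷ b ∷ s) × MinOrMax b (a ∷ b ∷ s)

-- In a skew tree each internal node has at most one internal child, so the
-- pre-order word walks down a single path, and the label of a node (relative
-- to the labels below it) says whether its leaf child is on the left or the
-- right. Skewness rules out every rotation except node (node leaf D) leaf ↦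
-- node leaf (node D leaf) at some node of the path; it swaps the node's label,
-- the maximum of the rest of the word, with its child's, the minimum. Conversely,
-- two skew trees whose words agree up to an adjacent swap have the same shape
-- down to the swap, and there the two labels force exactly that rotation.
module Submission where

open import Defs
open import Data.Nat using (ℕ; zero; suc; _+_; _≤_; _<_; z≤n; s≤s)
open import Data.Nat.Properties
open import Data.Nat.Tactic.RingSolver using (solve-∀)
open import Data.List using (List; []; _∷_; _++_; length)
open import Data.List.Properties using (∷-injective; ∷-injectiveˡ; ∷-injectiveʳ; ++-identityʳ; length-++)
open import Data.List.Relation.Unary.All as All using (All; []; _∷_)
open import Data.List.Relation.Unary.All.Properties using (++⁺)
open import Data.Product using (_×_; _,_)
open import Data.Sum using (inj₁; inj₂)
open import Data.Empty using (⊥-elim)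
open import Relation.Nullary using (¬_)
open import Relation.Binary.PropositionalEquality
  using (_≡_; _≢_; refl; sym; trans; cong; cong₂; subst; module ≡-Reasoning)

++-injective : ∀ {A : Set} {xs xs′ ys ys′ : List A} → length xs ≡ length xs′ →
               xs ++ ys ≡ xs′ ++ ys′ → xs ≡ xs′ × ys ≡ ys′
++-injective {xs = []}     {[]}     _    eq = refl , eq
++-injective {xs = x ∷ xs} {_ ∷ xs′} |xs| eq with ∷-injective eq
... | refl , eq′ with ++-injective {xs = xs} {xs′} (suc-injective |xs|) eq′
...   | refl , ys≡ys′ = refl , ys≡ys′

[]≢++∷ : ∀ {A : Set} (p : List A) {x xs} → [] ≢ p ++ x ∷ xs
[]≢++∷ []      ()
[]≢++∷ (_ ∷ _) ()

label-injective : ∀ k {m n} → k + m + 1 ≡ k + n + 1 → m ≡ n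
label-injective k {m} {n} eq = +-cancelˡ-≡ k m n (+-cancelʳ-≡ 1 (k + m) (k + n) eq)

k<label : ∀ k m → k < k + m + 1
k<label k m = ≤-<-trans (m≤m+n k m) (m<m+n (k + m) (s≤s z≤n))

label+≡ : ∀ k m n → k + m + 1 + n ≡ k + suc (m + n)
label+≡ = solve-∀

rotated-label≡ : ∀ k d → k + 0 + 1 + d + 1 ≡ k + suc d + 1
rotated-label≡ = solve-∀

internal≡0⇒leaf : ∀ T → internal T ≡ 0 → T ≡ leaf
internal≡0⇒leaf leaf _ = refl

preorder-length : ∀ k T → length (preorder k T) ≡ internal T
preorder-length k leaf       = refl
preorder-length k (node l r) = cong suc (begin
  length (preorder k l ++ preorder _ r)          ≡⟨ length-++ (preorder k l) ⟩
  length (preorder k l) + length (preorder _ r)  ≡⟨ cong₂ _+_ (preorder-length k l) (preorder-length _ r) ⟩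
  internal l + internal r                        ∎)
  where open ≡-Reasoning

preorder-injective : ∀ k {T T′} → preorder k T ≡ preorder k T′ → T ≡ T′
preorder-injective k {leaf}     {leaf}       _  = refl
preorder-injective k {node l r} {node l′ r′} eq
  with root≡ , rest≡ ← ∷-injective eq
  with l≡l′ , r≡r′ ← ++-injective {xs = preorder k l} (trans (preorder-length k l)
                                   (trans (label-injective k root≡) (sym (preorder-length k l′))))
                                 rest≡
  with refl ← preorder-injective k {l} {l′} l≡l′
  = cong (node l) (preorder-injective _ r≡r′)

preorder-lower : ∀ k T → All (k <_) (preorder k T)
preorder-lower k leaf       = []
preorder-lower k (node l r) =
  k<label k (internal l)
  ∷ ++⁺ (preorder-lower k l)
        (All.map (<-trans (k<label k (internal l))) (preorder-lower _ r))

preorder-upper : ∀ k T → All (_≤ k + internal T) (preorder k T)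
preorder-upper k leaf       = []
preorder-upper k (node l r) =
  root≤ ∷ ++⁺ (All.map (λ x≤ → ≤-trans x≤ (≤-trans (m≤m+n (k + internal l) 1) root≤))
                       (preorder-upper k l))
              (All.map (λ x≤ → ≤-trans x≤ (≤-reflexive bound≡)) (preorder-upper _ r))
  where
  bound≡ : k + internal l + 1 + internal r ≡ k + suc (internal l + internal r)
  bound≡ = label+≡ k (internal l) (internal r)
  root≤ : k + internal l + 1 ≤ k + suc (internal l + internal r)
  root≤ = ≤-trans (m≤m+n _ (internal r)) (≤-reflexive bound≡)

preorder-leafʳ : ∀ k l → preorder k (node l leaf) ≡ (k + internal l + 1) ∷ preorder k l
preorder-leafʳ k l = cong (k + internal l + 1 ∷_) (++-identityʳ (preorder k l))

preorder-rotated-root : ∀ k D → preorder k (node leaf (node D leaf)) ≡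
  (k + 0 + 1) ∷ (k + suc (internal D) + 1) ∷ preorder (k + 0 + 1) D ++ []
preorder-rotated-root k D =
  cong (λ m → k + 0 + 1 ∷ m ∷ preorder (k + 0 + 1) D ++ []) (rotated-label≡ k (internal D))

root-ascent : ∀ k r {u v s} → preorder k (node leaf r) ≡ u ∷ v ∷ s → u < v
root-ascent k r eq with ∷-injective eq
... | refl , rest≡ = All.head (subst (All _) rest≡ (preorder-lower _ r))

root-descent : ∀ k x y z {u v s} → preorder k (node (node x y) z) ≡ u ∷ v ∷ s → v < u
root-descent k x y z refl =
  +-monoˡ-< 1 (+-monoʳ-< k (s≤s (m≤m+n (internal x) (internal y))))

RRot-internal : ∀ {T T′} → RRot T T′ → internal T ≡ internal T′
RRot-internal (here C D E) = cong suc (assoc (internal C) (internal D) (internal E))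
  where
  assoc : ∀ c d e → suc (c + d) + e ≡ c + suc (d + e)
  assoc = solve-∀
RRot-internal (left B r)  = cong (λ m → suc (m + internal B)) (RRot-internal r)
RRot-internal (right A r) = cong (λ m → suc (internal A + m)) (RRot-internal r)

RRot-irreflexive : ∀ {T} → ¬ RRot T T
RRot-irreflexive (left _ r)  = RRot-irreflexive r
RRot-irreflexive (right _ r) = RRot-irreflexive r

Rot-irreflexive : ∀ {T} → ¬ Rot T T
Rot-irreflexive (inj₁ r) = RRot-irreflexive r
Rot-irreflexive (inj₂ r) = RRot-irreflexive r

Rot-left : ∀ {A A′} B → Rot A A′ → Rot (node A B) (node A′ B)
Rot-left B (inj₁ r) = inj₁ (left B r)
Rot-left B (inj₂ r) = inj₂ (left B r)

Rot-right : ∀ A {B B′} → Rot B B′ → Rot (node A B) (node A B′)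
Rot-right A (inj₁ r) = inj₁ (right A r)
Rot-right A (inj₂ r) = inj₂ (right A r)

Dist1⇒Rot : ∀ {T T′} → Dist T T′ 1 → Rot T T′
Dist1⇒Rot (step r stop , _) = r

Rot⇒Dist1 : ∀ {T T′} → Rot T T′ → Dist T T′ 1
Rot⇒Dist1 r = step r stop , λ { zero _ stop → Rot-irreflexive r ; (suc _) (s≤s ()) }

∼-cons : ∀ x {xs ys} → xs ∼ ys → (x ∷ xs) ∼ (x ∷ ys)
∼-cons x (p , a , b , s , xs≡ , ys≡ , a-mm , b-mm) =
  x ∷ p , a , b , s , cong (x ∷_) xs≡ , cong (x ∷_) ys≡ , a-mm , b-mm

MinOrMax-swap : ∀ {x a b s} → MinOrMax x (a ∷ b ∷ s) → MinOrMax x (b ∷ a ∷ s)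
MinOrMax-swap (inj₁ (pa ∷ pb ∷ ps)) = inj₁ (pb ∷ pa ∷ ps)
MinOrMax-swap (inj₂ (pa ∷ pb ∷ ps)) = inj₂ (pb ∷ pa ∷ ps)

∼-sym : ∀ {xs ys} → xs ∼ ys → ys ∼ xs
∼-sym (p , a , b , s , xs≡ , ys≡ , a-mm , b-mm) =
  p , b , a , s , ys≡ , xs≡ , MinOrMax-swap b-mm , MinOrMax-swap a-mm

root-rotation⇒∼ : ∀ k D →
  preorder k (node (node leaf D) leaf) ∼ preorder k (node leaf (node D leaf))
root-rotation⇒∼ k D =
  [] , top , bottom , rest , refl , preorder-rotated-root k D ,
  inj₂ (≤-refl ∷ bottom≤top ∷ ++⁺ (All.map (λ x≤ → ≤-trans x≤ D≤top) (preorder-upper bottom D)) []) ,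
  inj₁ (bottom≤top ∷ ≤-refl ∷ ++⁺ (All.map <⇒≤ (preorder-lower bottom D)) [])
  where
  bottom top : ℕ
  bottom = k + 0 + 1
  top    = k + suc (internal D) + 1
  rest : List ℕ
  rest = preorder bottom D ++ []
  bottom≤top : bottom ≤ top
  bottom≤top = +-monoˡ-≤ 1 (+-monoʳ-≤ k z≤n)
  D≤top : bottom + internal D ≤ top
  D≤top = ≤-trans (m≤m+n _ 1) (≤-reflexive (rotated-label≡ k (internal D)))

RRot⇒∼ : ∀ k {T T′} → RRot T T′ → Skew T → Skew T′ → preorder k T ∼ preorder k T′
RRot⇒∼ k (here .leaf D .leaf) (skew-R _) (skew-L _) = root-rotation⇒∼ k D
RRot⇒∼ k (left {A} {A′} _ r) (skew-R s) (skew-R s′)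
  rewrite preorder-leafʳ k A | preorder-leafʳ k A′ | RRot-internal r =
  ∼-cons _ (RRot⇒∼ k r s s′)
RRot⇒∼ k (right _ r) (skew-L s) (skew-L s′) = ∼-cons _ (RRot⇒∼ (k + 0 + 1) r s s′)
RRot⇒∼ k (left _ ())  (skew-L _) _
RRot⇒∼ k (left _ ())  (skew-R _) (skew-L _)
RRot⇒∼ k (right _ ()) (skew-R _) _
RRot⇒∼ k (right _ ()) (skew-L _) (skew-R _)

Rot⇒∼ : ∀ k {T T′} → Skew T → Skew T′ → Rot T T′ → preorder k T ∼ preorder k T′
Rot⇒∼ k s s′ (inj₁ r) = RRot⇒∼ k r s s′
Rot⇒∼ k s s′ (inj₂ r) = ∼-sym (RRot⇒∼ k r s′ s)

data SkewNode : Tree → Set where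
  leaf-left  : ∀ {r} → Skew r → SkewNode (node leaf r)
  leaf-right : ∀ {x y} → Skew (node x y) → SkewNode (node (node x y) leaf)

skewNode : ∀ {l r} → Skew (node l r) → SkewNode (node l r)
skewNode (skew-L s)            = leaf-left s
skewNode (skew-R {leaf} _)     = leaf-left skew-leaf
skewNode (skew-R {node _ _} s) = leaf-right s

root-swap⇒RRot : ∀ k r x y {a b s} →
  preorder k (node leaf r) ≡ a ∷ b ∷ s → preorder k (node (node x y) leaf) ≡ b ∷ a ∷ s →
  RRot (node (node x y) leaf) (node leaf r)
root-swap⇒RRot k r x y eq refl
  with internal≡0⇒leaf x (sym (label-injective k (∷-injectiveˡ eq)))
... | refl = subst (RRot _) (preorder-injective k (trans (preorder-rotated-root k y) (sym eq)))
                   (here leaf y leaf)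

transposition⇒Rot : ∀ p k {T T′ a b s} → Skew T → Skew T′ →
  preorder k T ≡ p ++ a ∷ b ∷ s → preorder k T′ ≡ p ++ b ∷ a ∷ s → Rot T T′
transposition⇒Rot p k {leaf}                _ _  eq _   = ⊥-elim ([]≢++∷ p eq)
transposition⇒Rot p k {node _ _} {leaf}     _ _  _  eq′ = ⊥-elim ([]≢++∷ p eq′)
transposition⇒Rot p k {node _ _} {node _ _} s s′ eq eq′ = at-nodes p (skewNode s) (skewNode s′) eq eq′
  where
  at-nodes : ∀ p {T T′ a b s} → SkewNode T → SkewNode T′ →
    preorder k T ≡ p ++ a ∷ b ∷ s → preorder k T′ ≡ p ++ b ∷ a ∷ s → Rot T T′
  at-nodes [] (leaf-left {r} _) (leaf-left {r′} _) eq eq′ =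
    ⊥-elim (<-asym (root-ascent k r eq) (root-ascent k r′ eq′))
  at-nodes [] (leaf-right {x} {y} _) (leaf-right {x′} {y′} _) eq eq′ =
    ⊥-elim (<-asym (root-descent k x y leaf eq) (root-descent k x′ y′ leaf eq′))
  at-nodes [] (leaf-left {r} _) (leaf-right {x} {y} _) eq eq′ = inj₂ (root-swap⇒RRot k r x y eq eq′)
  at-nodes [] (leaf-right {x} {y} _) (leaf-left {r} _) eq eq′ = inj₁ (root-swap⇒RRot k r x y eq′ eq)
  at-nodes (_ ∷ p) (leaf-left s) (leaf-left s′) eq eq′ =
    Rot-right leaf (transposition⇒Rot p _ s s′ (∷-injectiveʳ eq) (∷-injectiveʳ eq′))
  at-nodes (_ ∷ p) (leaf-right {x} {y} s) (leaf-right {x′} {y′} s′) eq eq′ =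
    Rot-left leaf (transposition⇒Rot p k s s′
      (∷-injectiveʳ (trans (sym (preorder-leafʳ k (node x y))) eq))
      (∷-injectiveʳ (trans (sym (preorder-leafʳ k (node x′ y′))) eq′)))
  at-nodes (_ ∷ p) (leaf-left _) (leaf-right _) eq eq′ =
    ⊥-elim (0≢1+n (label-injective k (trans (∷-injectiveˡ eq) (sym (∷-injectiveˡ eq′)))))
  at-nodes (_ ∷ p) (leaf-right _) (leaf-left _) eq eq′ =
    ⊥-elim (0≢1+n (label-injective k (trans (∷-injectiveˡ eq′) (sym (∷-injectiveˡ eq)))))

lemma6 : (n : ℕ) (T₁ T₂ : Tree) → Skew T₁ → Skew T₂ →
         internal T₁ ≡ n → internal T₂ ≡ n →
         (Dist T₁ T₂ 1 → perm T₁ ∼ perm T₂) × (perm T₁ ∼ perm T₂ → Dist T₁ T₂ 1)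
lemma6 n T₁ T₂ s₁ s₂ _ _ =
  (λ d → Rot⇒∼ 0 s₁ s₂ (Dist1⇒Rot d)) ,
  λ { (p , _ , _ , _ , σ≡ , τ≡ , _) → Rot⇒Dist1 (transposition⇒Rot p 0 s₁ s₂ σ≡ τ≡) }
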